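{- Let $G=(S\cup K,E)$ be a split graph, where $S$ is an independent set and $K$ is a clique of $G$, and assume $K$ is a maximum clique of $G$, i.e. $\omega(G)=|K|$. Then $\omega(G)\leq Tr(G)\leq \omega(G)+1$. Further, $Tr(G)=\omega(G)+1$ if and only if every vertex of $K$ has a neighbour in $S$.
   Context: All graphs are finite and simple. For disjoint $A,B\subseteq V$, $A$ dominates $B$ if every vertex of $B$ is adjacent to at least one vertex of $A$. A transitive $k$-partition of $G=(V,E)$ is a partition $\{V_1,\dots,V_k\}$ of $V$ into $k$ (nonempty) parts such that $V_i$ dominates $V_j$ for all $1\le i<j\le k$. The transitivity $Tr(G)$ is the maximum $k$ for which a transitive $k$-partition exists. A split graph is a graph whose vertex set can be partitioned into an independent set and a clique; $\omega(G)$ is the size of a maximum clique. -}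

module Defs where

open import Data.Nat using (ℕ; _≤_; _<_; _+_; suc)
open import Data.Fin using (Fin; toℕ)
open import Data.Fin.Subset using (Subset; _∈_; _∉_; ∣_∣)
open import Data.Product using (Σ; ∃; ∃-syntax; _×_; _,_)
open import Data.Sum using (_⊎_)
open import Relation.Nullary using (¬_; Dec)
open import Relation.Binary.PropositionalEquality using (_≡_; _≢_)
open import Function.Bundles using (_⇔_)

record Graph (n : ℕ) : Set₁ where
  field
    Adj     : Fin n → Fin n → Set
    adj?    : ∀ u v → Dec (Adj u v)
    sym     : ∀ {u v} → Adj u v → Adj v u
    irrefl  : ∀ {u} → ¬ Adj u u
open Graph public

module _ {n : ℕ} (G : Graph n) where

  IsClique : Subset n → Set
  IsClique C = ∀ u v → u ∈ C → v ∈ C → u ≢ v → Adj G u v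

  IsIndependent : Subset n → Set
  IsIndependent I = ∀ u v → u ∈ I → v ∈ I → ¬ Adj G u v

  IsMaximumClique : Subset n → Set
  IsMaximumClique K = IsClique K × (∀ C → IsClique C → ∣ C ∣ ≤ ∣ K ∣)

  IsSplitPartition : Subset n → Subset n → Set
  IsSplitPartition S K =
    IsIndependent S × IsClique K ×
    (∀ v → v ∈ S ⊎ v ∈ K) × (∀ v → v ∈ S → v ∉ K)

  -- A partition of V into k nonempty parts, given as a map f : V → Fin k
  -- (V_i = f ⁻¹ {i}); transitive if V_i dominates V_j for all i < j.
  IsTransitivePartition : (k : ℕ) → (Fin n → Fin k) → Set
  IsTransitivePartition k f =
    (∀ (i : Fin k) → ∃[ v ] f v ≡ i) ×
    (∀ (i j : Fin k) → toℕ i < toℕ j →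
       ∀ v → f v ≡ j → ∃[ u ] (f u ≡ i × Adj G u v))

  HasTransitivePartition : ℕ → Set
  HasTransitivePartition k = ∃[ f ] IsTransitivePartition k f

  IsTransitivity : ℕ → Set
  IsTransitivity t = HasTransitivePartition t × (∀ k → HasTransitivePartition k → k ≤ t)

{-# OPTIONS --safe #-}
module Submission where

open import Defs hiding (sym)
open import Data.Nat using (ℕ; _≤_; _+_; suc)
open import Data.Fin using (Fin)
open import Data.Fin.Subset using (Subset; _∈_; ∣_∣)
open import Data.Product using (∃-syntax; _×_)
open import Function.Bundles using (_⇔_)
open import Relation.Binary.PropositionalEquality using (_≡_)

open import Data.Nat using (_<_; s<s⁻¹; s≤s⁻¹)
import Data.Nat.Properties as ℕ
open import Data.Fin using (zero; suc; toℕ; fromℕ<; _≟_)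
open import Data.Fin.Properties
  using (pigeonhole; injective⇒≤; <-cmp; <⇒≢; toℕ-fromℕ<; suc-injective; all?; any?)
open import Data.Fin.Subset using (inside; outside; _∉_; ⁅_⁆)
open import Data.Fin.Subset.Properties using (_∈?_; x∈⁅y⁆⇒x≡y; ∣⁅x⁆∣≡1)
open import Data.Vec using (_∷_; here; there)
open import Data.Vec.Properties.WithK using ([]=-irrelevant)
import Data.Vec.Functional as Vector
open import Data.Product using (Σ; _,_; proj₁; proj₂)
open import Data.Sum using (inj₁; inj₂)
open import Data.Empty using (⊥; ⊥-elim)
open import Function using (_∘_)
open import Function.Bundles using (mk⇔)
open import Function.Definitions using (Injective)
open import Relation.Nullary using (¬_; Dec; yes; no; contradiction)
open import Relation.Nullary.Decidable using (_×-dec_; _→-dec_)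
open import Relation.Binary using (tri<; tri≈; tri>)
open import Relation.Binary.PropositionalEquality
  using (_≢_; refl; sym; trans; cong; subst)

-- Lower bound: make S together with the first vertex of K one part and every
-- other vertex of K a singleton part; the clique makes the singletons dominate
-- each other.  If S dominates K, S can even form a part of its own below all the
-- singletons.  Upper bound: two parts avoiding K would be two nonempty subsets
-- of the independent set S, one dominating the other, so all parts but at most
-- one contain a vertex of K, and distinct parts contain distinct such vertices.
-- With |K| + 1 parts this count is tight: exactly one part avoids K and every
-- other part meets K in a single vertex.  A vertex v of K then has a neighbour
-- in S: the K-free part lies either below v's part and dominates v, or above
-- it and is dominated by a vertex of v's part, which can only be v itself.

rank : ∀ {n} (K : Subset n) {v} → v ∈ K → Fin ∣ K ∣
rank (inside ∷ K) here = zero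
rank (inside ∷ K) (there p) = suc (rank K p)
rank (outside ∷ K) (there p) = rank K p

rank-injective : ∀ {n} (K : Subset n) {u v} (p : u ∈ K) (q : v ∈ K) →
                 rank K p ≡ rank K q → u ≡ v
rank-injective (inside ∷ K) here here _ = refl
rank-injective (inside ∷ K) (there p) (there q) eq =
  cong suc (rank-injective K p q (suc-injective eq))
rank-injective (outside ∷ K) (there p) (there q) eq =
  cong suc (rank-injective K p q eq)

rank-surjective : ∀ {n} (K : Subset n) (i : Fin ∣ K ∣) →
                  ∃[ v ] Σ (v ∈ K) λ p → rank K p ≡ i
rank-surjective (inside ∷ K) zero = zero , here , refl
rank-surjective (inside ∷ K) (suc i) with v , p , eq ← rank-surjective K i =
  suc v , there p , cong suc eq
rank-surjective (outside ∷ K) i with v , p , eq ← rank-surjective K i =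
  suc v , there p , eq

injective-endo⇒surjective : ∀ {m} {f : Fin m → Fin m} →
                            Injective _≡_ _≡_ f → ∀ y → ∃[ x ] f x ≡ y
injective-endo⇒surjective {m} {f} f-injective y
  with pigeonhole (ℕ.n<1+n m) (y Vector.∷ f)
... | zero , suc x , _ , y≡fx = x , sym y≡fx
... | suc x , suc x′ , x<x′ , fx≡fx′ =
  contradiction (f-injective fx≡fx′) (<⇒≢ (s<s⁻¹ x<x′))

singleton-isClique : ∀ {n} (G : Graph n) (x : Fin n) → IsClique G ⁅ x ⁆
singleton-isClique G x u v u∈ v∈ u≢v =
  contradiction (trans (x∈⁅y⁆⇒x≡y x u∈) (sym (x∈⁅y⁆⇒x≡y x v∈))) u≢v

module SplitGraph {n} (G : Graph n) (S K : Subset n)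
                  (split : IsSplitPartition G S K) where

  S-independent : IsIndependent G S
  S-independent = proj₁ split

  K-clique : IsClique G K
  K-clique = proj₁ (proj₂ split)

  ∉K⇒∈S : ∀ {v} → v ∉ K → v ∈ S
  ∉K⇒∈S {v} v∉K with proj₁ (proj₂ (proj₂ split)) v
  ... | inj₁ v∈S = v∈S
  ... | inj₂ v∈K = contradiction v∈K v∉K

  ∈S⇒∉K : ∀ {v} → v ∈ S → v ∉ K
  ∈S⇒∉K = proj₂ (proj₂ (proj₂ split)) _

  SDominatesK : Set
  SDominatesK = ∀ v → v ∈ K → ∃[ u ] (u ∈ S × Adj G u v)

  SDominatesK? : Dec SDominatesK
  SDominatesK? =
    all? λ v → (v ∈? K) →-dec any? λ u → (u ∈? S) ×-dec adj? G u v

  rank-neighbour : ∀ {v} (v∈K : v ∈ K) (i : Fin ∣ K ∣) → i ≢ rank K v∈K →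
                   ∃[ u ] Σ (u ∈ K) λ u∈K → rank K u∈K ≡ i × Adj G u v
  rank-neighbour {v} v∈K i i≢rank with u , u∈K , eq ← rank-surjective K i =
    u , u∈K , eq , K-clique _ _ u∈K v∈K u≢v
    where
    u≢v : u ≢ v
    u≢v refl = i≢rank (trans (sym eq) (cong (rank K) ([]=-irrelevant u∈K v∈K)))

  layout : ∀ {k} → (Fin ∣ K ∣ → Fin k) → Fin k → Fin n → Fin k
  layout onK onS v with v ∈? K
  ... | yes v∈K = onK (rank K v∈K)
  ... | no _ = onS

  module _ {k} (onK : Fin ∣ K ∣ → Fin k) (onS : Fin k) where

    layout-∈K : ∀ {v} (v∈K : v ∈ K) → layout onK onS v ≡ onK (rank K v∈K)
    layout-∈K {v} v∈K with v ∈? K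
    ... | yes v∈K′ = cong (onK ∘ rank K) ([]=-irrelevant v∈K′ v∈K)
    ... | no v∉K = contradiction v∈K v∉K

    layout-∉K : ∀ {v} → v ∉ K → layout onK onS v ≡ onS
    layout-∉K {v} v∉K with v ∈? K
    ... | yes v∈K = contradiction v∈K v∉K
    ... | no _ = refl

  module _ (K-nonempty : 0 < ∣ K ∣) where

    bottom : Fin ∣ K ∣
    bottom = fromℕ< K-nonempty

    byRank : Fin n → Fin ∣ K ∣
    byRank = layout (λ i → i) bottom

    byRank-isTransitive : IsTransitivePartition G ∣ K ∣ byRank
    byRank-isTransitive = covers , dominates
      where
      covers : ∀ i → ∃[ v ] byRank v ≡ i
      covers i with v , v∈K , eq ← rank-surjective K i =
        v , trans (layout-∈K _ bottom v∈K) eq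
      dominates : ∀ i j → toℕ i < toℕ j → ∀ v → byRank v ≡ j →
                  ∃[ u ] (byRank u ≡ i × Adj G u v)
      dominates i _ i<j v refl with v ∈? K
      ... | no _ = contradiction (subst (toℕ i <_) (toℕ-fromℕ< K-nonempty) i<j) ℕ.n≮0
      ... | yes v∈K with u , u∈K , eq , adj ← rank-neighbour v∈K i (<⇒≢ i<j) =
        u , trans (layout-∈K _ bottom u∈K) eq , adj

    SThenByRank : Fin n → Fin (suc ∣ K ∣)
    SThenByRank = layout suc zero

    SThenByRank-isTransitive : SDominatesK → IsTransitivePartition G (suc ∣ K ∣) SThenByRank
    SThenByRank-isTransitive S↠K = covers , dominates
      where
      ∈S⇒↦zero : ∀ {u} → u ∈ S → SThenByRank u ≡ zero
      ∈S⇒↦zero = layout-∉K suc zero ∘ ∈S⇒∉K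
      covers : ∀ i → ∃[ v ] SThenByRank v ≡ i
      covers zero =
        let v , v∈K , _ = rank-surjective K bottom
            u , u∈S , _ = S↠K v v∈K
        in u , ∈S⇒↦zero u∈S
      covers (suc i) with v , v∈K , eq ← rank-surjective K i =
        v , trans (layout-∈K suc zero v∈K) (cong suc eq)
      dominates : ∀ i j → toℕ i < toℕ j → ∀ v → SThenByRank v ≡ j →
                  ∃[ u ] (SThenByRank u ≡ i × Adj G u v)
      dominates i _ i<j v refl with v ∈? K
      dominates zero _ _ v refl | yes v∈K with u , u∈S , adj ← S↠K v v∈K =
        u , ∈S⇒↦zero u∈S , adj
      dominates (suc i) _ i<j v refl | yes v∈K
        with u , u∈K , eq , adj ← rank-neighbour v∈K i (<⇒≢ (s<s⁻¹ i<j)) =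
        u , trans (layout-∈K suc zero u∈K) (cong suc eq) , adj

  module Partition {k} {f : Fin n → Fin k} (transitive : IsTransitivePartition G k f) where

    covers : ∀ i → ∃[ v ] f v ≡ i
    covers = proj₁ transitive

    dominates : ∀ i j → toℕ i < toℕ j → ∀ v → f v ≡ j → ∃[ u ] (f u ≡ i × Adj G u v)
    dominates = proj₂ transitive

    MeetsK : Fin k → Set
    MeetsK i = ∃[ w ] (w ∈ K × f w ≡ i)

    meetsK? : ∀ i → Dec (MeetsK i)
    meetsK? i = any? λ w → (w ∈? K) ×-dec (f w ≟ i)

    avoidsK⇒∈S : ∀ {i v} → ¬ MeetsK i → f v ≡ i → v ∈ S
    avoidsK⇒∈S i∌K v↦i = ∉K⇒∈S λ v∈K → i∌K (_ , v∈K , v↦i)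

    avoidsK<avoidsK⇒⊥ : ∀ {i j} → toℕ i < toℕ j → ¬ MeetsK i → ¬ MeetsK j → ⊥
    avoidsK<avoidsK⇒⊥ {i} {j} i<j i∌K j∌K =
      let v , v↦j = covers j
          u , u↦i , adj = dominates i j i<j v v↦j
      in S-independent u v (avoidsK⇒∈S i∌K u↦i) (avoidsK⇒∈S j∌K v↦j) adj

    avoidsK-unique : ∀ {i j} → ¬ MeetsK i → ¬ MeetsK j → i ≡ j
    avoidsK-unique {i} {j} i∌K j∌K with <-cmp i j
    ... | tri< i<j _ _ = ⊥-elim (avoidsK<avoidsK⇒⊥ i<j i∌K j∌K)
    ... | tri≈ _ i≡j _ = i≡j
    ... | tri> _ _ j<i = ⊥-elim (avoidsK<avoidsK⇒⊥ j<i j∌K i∌K)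

    tag : Fin k → Fin (suc ∣ K ∣)
    tag i with meetsK? i
    ... | yes (_ , w∈K , _) = suc (rank K w∈K)
    ... | no _ = zero

    tag≡zero⇒avoidsK : ∀ {i} → tag i ≡ zero → ¬ MeetsK i
    tag≡zero⇒avoidsK {i} eq with meetsK? i
    tag≡zero⇒avoidsK () | yes _
    ... | no i∌K = i∌K

    tag≡suc⇒meetsK : ∀ {i r} → tag i ≡ suc r →
                     ∃[ w ] Σ (w ∈ K) λ w∈K → f w ≡ i × rank K w∈K ≡ r
    tag≡suc⇒meetsK {i} eq with meetsK? i
    ... | yes (w , w∈K , w↦i) = w , w∈K , w↦i , suc-injective eq
    tag≡suc⇒meetsK () | no _

    tag-injective : Injective _≡_ _≡_ tag
    tag-injective {i} {j} eq with meetsK? i | meetsK? j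
    ... | yes (u , u∈K , u↦i) | yes (v , v∈K , v↦j)
      with refl ← rank-injective K u∈K v∈K (suc-injective eq) = trans (sym u↦i) v↦j
    ... | no i∌K | no j∌K = avoidsK-unique i∌K j∌K
    tag-injective () | yes _ | no _
    tag-injective () | no _ | yes _

    ≤1+∣K∣ : k ≤ suc ∣ K ∣
    ≤1+∣K∣ = injective⇒≤ tag-injective

  module Saturated {f : Fin n → Fin (suc ∣ K ∣)}
                   (transitive : IsTransitivePartition G (suc ∣ K ∣) f) where
    open Partition transitive

    tag-surjective : ∀ r → ∃[ i ] tag i ≡ r
    tag-surjective = injective-endo⇒surjective tag-injective

    tag-∈K : ∀ {v} (v∈K : v ∈ K) → tag (f v) ≡ suc (rank K v∈K)
    tag-∈K v∈K =
      let i , i↦ = tag-surjective (suc (rank K v∈K))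
          w , w∈K , w↦i , rank≡ = tag≡suc⇒meetsK i↦
      in trans (cong (tag ∘ f) (sym (rank-injective K w∈K v∈K rank≡)))
               (trans (cong tag w↦i) i↦)

    injectiveOnK : ∀ {u v} → u ∈ K → v ∈ K → f u ≡ f v → u ≡ v
    injectiveOnK u∈K v∈K u~v = rank-injective K u∈K v∈K
      (suc-injective (trans (sym (tag-∈K u∈K)) (trans (cong tag u~v) (tag-∈K v∈K))))

    adjacent-to-S⇒≡ : ∀ {u v x} → v ∈ K → f u ≡ f v → x ∈ S → Adj G u x → u ≡ v
    adjacent-to-S⇒≡ {u} {v} {x} v∈K u~v x∈S adj with u ∈? K
    ... | yes u∈K = injectiveOnK u∈K v∈K u~v
    ... | no u∉K = ⊥-elim (S-independent u x (∉K⇒∈S u∉K) x∈S adj)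

    avoidsK⇒SDominatesK : ∀ {s} → ¬ MeetsK s → SDominatesK
    avoidsK⇒SDominatesK {s} s∌K v v∈K with <-cmp (f v) s
    ... | tri≈ _ v↦s _ = contradiction (v , v∈K , v↦s) s∌K
    ... | tri> _ _ s<v =
      let u , u↦s , adj = dominates s (f v) s<v v refl
      in u , avoidsK⇒∈S s∌K u↦s , adj
    ... | tri< v<s _ _ =
      let x , x↦s = covers s
          u , u~v , adj = dominates (f v) s v<s x x↦s
          x∈S = avoidsK⇒∈S s∌K x↦s
      in x , x∈S , Graph.sym G (subst (λ u → Adj G u x) (adjacent-to-S⇒≡ v∈K u~v x∈S adj) adj)

    sDominatesK : SDominatesK
    sDominatesK =
      let _ , s↦zero = tag-surjective zero in avoidsK⇒SDominatesK (tag≡zero⇒avoidsK s↦zero)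

lemma1 : ∀ {n : ℕ} → 1 ≤ n → (G : Graph n) → (S K : Subset n) →
    IsSplitPartition G S K → IsMaximumClique G K →
    (∃[ t ] IsTransitivity G t) ×
    (∀ t → IsTransitivity G t →
      (∣ K ∣ ≤ t) × (t ≤ ∣ K ∣ + 1) ×
      ((t ≡ ∣ K ∣ + 1) ⇔ (∀ v → v ∈ K → ∃[ u ] (u ∈ S × Adj G u v))))
lemma1 {suc m} _ G S K split (_ , maximum) rewrite ℕ.+-comm ∣ K ∣ 1 =
  transitivity , transitivity-bounds
  where
  open SplitGraph G S K split

  K-nonempty : 0 < ∣ K ∣
  K-nonempty = subst (_≤ ∣ K ∣) (∣⁅x⁆∣≡1 (zero {m}))
    (maximum ⁅ zero ⁆ (singleton-isClique G zero))

  lower : HasTransitivePartition G ∣ K ∣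
  lower = byRank K-nonempty , byRank-isTransitive K-nonempty

  upper : SDominatesK → HasTransitivePartition G (suc ∣ K ∣)
  upper S↠K = SThenByRank K-nonempty , SThenByRank-isTransitive K-nonempty S↠K

  ≤1+∣K∣ : ∀ {k} → HasTransitivePartition G k → k ≤ suc ∣ K ∣
  ≤1+∣K∣ (_ , transitive) = Partition.≤1+∣K∣ transitive

  upper⇒SDominatesK : HasTransitivePartition G (suc ∣ K ∣) → SDominatesK
  upper⇒SDominatesK (_ , transitive) = Saturated.sDominatesK transitive

  transitivity : ∃[ t ] IsTransitivity G t
  transitivity with SDominatesK?
  ... | yes S↠K = suc ∣ K ∣ , upper S↠K , λ _ → ≤1+∣K∣
  ... | no ¬S↠K = ∣ K ∣ , lower , λ _ h →
    s≤s⁻¹ (ℕ.≤∧≢⇒< (≤1+∣K∣ h) λ { refl → ¬S↠K (upper⇒SDominatesK h) })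

  transitivity-bounds : ∀ t → IsTransitivity G t →
    (∣ K ∣ ≤ t) × (t ≤ suc ∣ K ∣) × ((t ≡ suc ∣ K ∣) ⇔ SDominatesK)
  transitivity-bounds t (has-t , maximal) =
    maximal _ lower , ≤1+∣K∣ has-t ,
    mk⇔ (λ { refl → upper⇒SDominatesK has-t })
        (λ S↠K → ℕ.≤-antisym (≤1+∣K∣ has-t) (maximal _ (upper S↠K)))
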